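{- Let $a,b$ be relatively prime integers with $0<a<b$. Define a permutation $\pi$ as follows: if $a=1$, let $n=b+1$ and $\pi=(2,3,\ldots,b+1,1)\in\mathcal{S}_n$; if $a\ge 2$, let $n=a+b$ and let $\pi=(\pi_1,\ldots,\pi_n)$ where $\pi_i$ is the unique element of $\{1,\ldots,n\}$ with $\pi_i\equiv 1+(i-1)a \pmod{a+b}$. (Then $\pi$ is a permutation with derivative value set $\{a,-b\}$.) Let $a'$ be the inverse of $a$ modulo $a+b$ (taken in $\{1,\ldots,a+b-1\}$) and let $b'=a+b-a'$. Then the set of discrete derivative values of $\pi^{ -1}$, namely $\{\pi^{ -1}_{i+1}-\pi^{ -1}_i: 1\le i\le n-1\}$, equals $\{a',-b'\}$; i.e., $(a',-b')$ is a $D$-pair realized by $\pi^{ -1}$.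
   Context: $\mathcal{S}_n$ denotes the set of permutations of $\{1,\ldots,n\}$. A pair $(p,q)$ of distinct integers is a $D$-pair realized by a permutation $\sigma\in\mathcal{S}_n$ if $\{\sigma_{i+1}-\sigma_i : i\le n-1\}=\{p,q\}$. -}

module Defs where

open import Data.Nat using (ℕ; zero; suc; _+_; _*_; _∸_; _≤_; _<_; _≟_; NonZero)
open import Data.Nat.DivMod using (_%_)
open import Data.Integer using (ℤ; +_; _-_)
open import Data.Product using (Σ; _×_; ∃-syntax)
open import Data.Sum using (_⊎_)
open import Relation.Nullary using (yes; no)
open import Relation.Binary.PropositionalEquality using (_≡_)
open import Function.Bundles using (_⇔_)

-- Permutations of {1,…,n} are represented in one-line notation as functions
-- ℕ → ℕ, of which only the values at 1,…,n matter.

rep : (n : ℕ) → .{{NonZero n}} → ℕ → ℕ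
rep n x with x % n ≟ 0
... | yes _ = n
... | no _  = x % n

sizeN : ℕ → ℕ → ℕ
sizeN 1 b = suc b
sizeN a b = a + b

πperm : ℕ → ℕ → ℕ → ℕ
πperm 1 b i with i ≟ suc b
... | yes _ = 1
... | no _  = suc i
πperm zero b i = i  -- never used (a > 0)
πperm a@(suc (suc k)) b i = rep (a + b) (1 + (i ∸ 1) * a)

IsInverseOn : ℕ → (ℕ → ℕ) → (ℕ → ℕ) → Set
IsInverseOn n π σ =
  (∀ i → 1 ≤ i → i ≤ n →
      (1 ≤ π i × π i ≤ n) × (1 ≤ σ i × σ i ≤ n) × π (σ i) ≡ i × σ (π i) ≡ i)

DerivValue : ℕ → (ℕ → ℕ) → ℤ → Set
DerivValue n σ d = ∃[ i ] (1 ≤ i × i ≤ n ∸ 1 × (+ σ (suc i) - + σ i) ≡ d)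

DerivSetIs : ℕ → (ℕ → ℕ) → ℤ → ℤ → Set
DerivSetIs n σ p q = ∀ d → DerivValue n σ d ⇔ (d ≡ p ⊎ d ≡ q)

IsInvMod : ℕ → ℕ → ℕ → Set
IsInvMod a m x = ∃[ k ] (a * x ≡ 1 + k * m)

-- For a ≥ 2 the permutation π is i ↦ 1 + (i − 1)a (mod n) with n = a + b, i.e.
-- multiplication by a on ℤ/n conjugated by the shift i ↦ i − 1, so its inverse
-- is multiplication by a′.  Along σ(i) = 1 + ((i − 1)a′ mod n) each step adds a′
-- to the residue, which either stays below n (difference a′) or wraps around
-- (difference a′ − n).  The first step does not wrap, and the step out of
-- q = ⌊(n − 1)/a′⌋ does, since q·a′ < n ≤ (q + 1)·a′.  For a = 1 the permutation
-- is a rotation, its inverse is the opposite rotation, and a′ is forced to be 1.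
module Submission where

open import Defs
open import Data.Nat
  using (ℕ; zero; suc; _+_; _*_; _∸_; _≤_; _<_; _≟_; z≤n; s≤s; NonZero; >-nonZero; >-nonZero⁻¹)
open import Data.Nat.Properties
open import Data.Nat.DivMod
open import Data.Nat.Coprimality using (Coprime)
open import Data.Integer using (+_; -_; _-_; _⊖_)
open import Data.Integer.Properties using ([+m]-[+n]≡m⊖n; ⊖-≥; ⊖-≤)
open import Data.Product using (Σ; _×_; _,_; proj₁)
open import Data.Sum using (_⊎_; inj₁; inj₂)
open import Data.Empty using (⊥-elim)
open import Relation.Nullary using (yes; no)
open import Relation.Binary.PropositionalEquality
open import Function.Bundles using (mk⇔)

+[m+n]-+n≡+m : ∀ m n → + (m + n) - + n ≡ + m
+[m+n]-+n≡+m m n = begin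
  + (m + n) - + n  ≡⟨ [+m]-[+n]≡m⊖n (m + n) n ⟩
  (m + n) ⊖ n      ≡⟨ ⊖-≥ (m≤n+m n m) ⟩
  + (m + n ∸ n)    ≡⟨ cong +_ (m+n∸n≡m m n) ⟩
  + m              ∎
  where open ≡-Reasoning

+m-+[m+n]≡-+n : ∀ m n → + m - + (m + n) ≡ - + n
+m-+[m+n]≡-+n m n = begin
  + m - + (m + n)  ≡⟨ [+m]-[+n]≡m⊖n m (m + n) ⟩
  m ⊖ (m + n)      ≡⟨ ⊖-≤ (m≤m+n m n) ⟩
  - + (m + n ∸ m)  ≡⟨ cong (λ k → - + k) (m+n∸m≡n m n) ⟩
  - + n            ∎
  where open ≡-Reasoning

%-absorbʳ-+ : ∀ m n d .{{_ : NonZero d}} → (m + n) % d ≡ (m + n % d) % d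
%-absorbʳ-+ m n d = begin
  (m + n) % d             ≡⟨ %-distribˡ-+ m n d ⟩
  (m % d + n % d) % d     ≡⟨ cong (λ k → (m % d + k) % d) (m%n%n≡m%n n d) ⟨
  (m % d + n % d % d) % d ≡⟨ %-distribˡ-+ m (n % d) d ⟨
  (m + n % d) % d         ∎
  where open ≡-Reasoning

%-absorbˡ-* : ∀ m n d .{{_ : NonZero d}} → (m % d * n) % d ≡ (m * n) % d
%-absorbˡ-* m n d = begin
  (m % d * n) % d           ≡⟨ %-distribˡ-* (m % d) n d ⟩
  (m % d % d * (n % d)) % d ≡⟨ cong (λ k → (k * (n % d)) % d) (m%n%n≡m%n m d) ⟩
  (m % d * (n % d)) % d     ≡⟨ %-distribˡ-* m n d ⟨
  (m * n) % d               ∎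
  where open ≡-Reasoning

[1+m]%n≡1+m%n : ∀ m n .{{_ : NonZero n}} → suc m % n ≢ 0 → suc m % n ≡ suc (m % n)
[1+m]%n≡1+m%n m n ≢0 with m≤n⇒m<n∨m≡n (m%n<n m n)
... | inj₁ lt = trans (%-absorbʳ-+ 1 m n) (m<n⇒m%n≡m lt)
... | inj₂ eq = ⊥-elim (≢0 (trans (%-absorbʳ-+ 1 m n) (trans (cong (_% n) eq) (n%n≡0 n))))

rep-suc : ∀ n .{{_ : NonZero n}} m → rep n (suc m) ≡ suc (m % n)
rep-suc n m with suc m % n ≟ 0
... | yes ≡0 = sym (trans (cong suc (%-pred-≡0 ≡0)) (m+[n∸m]≡n (>-nonZero⁻¹ n)))
... | no ≢0 = [1+m]%n≡1+m%n m n ≢0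

%-wrap : ∀ {c r n} .{{_ : NonZero n}} → c < n → r < n → n ≤ c + r → (c + r) % n + (n ∸ c) ≡ r
%-wrap {c} {r} {n} c<n r<n n≤c+r = +-cancelʳ-≡ c _ r (begin
  (c + r) % n + (n ∸ c) + c ≡⟨ cong (λ k → k + (n ∸ c) + c) c+r%n≡s ⟩
  s + (n ∸ c) + c           ≡⟨ +-assoc s (n ∸ c) c ⟩
  s + (n ∸ c + c)           ≡⟨ cong (λ k → s + k) (m∸n+n≡m (<⇒≤ c<n)) ⟩
  s + n                     ≡⟨ m∸n+n≡m n≤c+r ⟩
  c + r                     ≡⟨ +-comm c r ⟩
  r + c                     ∎)
  where
  open ≡-Reasoning
  s : ℕ
  s = c + r ∸ n
  s<n : s < n
  s<n = +-cancelʳ-< n s n (subst (_< n + n) (sym (m∸n+n≡m n≤c+r)) (+-mono-< c<n r<n))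
  c+r%n≡s : (c + r) % n ≡ s
  c+r%n≡s = trans (sym (m≤n⇒[n∸m]%m≡n%m n≤c+r)) (m<n⇒m%n≡m s<n)

m<n+[m/n]*n : ∀ m n .{{_ : NonZero n}} → m < n + (m / n) * n
m<n+[m/n]*n m n = subst (_< n + (m / n) * n) (sym (m≡m%n+[m/n]*n m n))
  (+-monoˡ-< ((m / n) * n) (m%n<n m n))

IsInvMod-small : ∀ {a n x} → IsInvMod a n x → a * x < n → a ≡ 1 × x ≡ 1
IsInvMod-small {a} {x = x} (zero , ax≡1) _ = m*n≡1⇒m≡1 a x ax≡1 , m*n≡1⇒n≡1 a x ax≡1
IsInvMod-small {n = n} (suc k , ax≡1+n+kn) ax<n =
  ⊥-elim (<⇒≱ ax<n (subst (n ≤_) (sym ax≡1+n+kn) (≤-trans (m≤m+n n (k * n)) (n≤1+n _))))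

IsInvMod-≢1 : ∀ {a n x} → IsInvMod a n x → 1 < a → a < n → x ≢ 1
IsInvMod-≢1 {a} {n} inv 1<a a<n refl =
  <⇒≢ 1<a (sym (proj₁ (IsInvMod-small inv (subst (_< n) (sym (*-identityʳ a)) a<n))))

IsInverseOn-congˡ : ∀ {n π π′ σ} → (∀ i → π i ≡ π′ i) →
  IsInverseOn n π′ σ → IsInverseOn n π σ
IsInverseOn-congˡ {n} {σ = σ} π≗π′ inv i 1≤i i≤n with inv i 1≤i i≤n
... | π′-range , σ-range , π′σ≡id , σπ′≡id =
  subst (λ k → 1 ≤ k × k ≤ n) (sym (π≗π′ i)) π′-range , σ-range ,
  trans (π≗π′ (σ i)) π′σ≡id , trans (cong σ (π≗π′ i)) σπ′≡id

module _ (n : ℕ) .{{_ : NonZero n}} where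

  mulPerm : ℕ → ℕ → ℕ
  mulPerm c i = suc ((i ∸ 1) * c % n)

  mulPerm-range : ∀ c i → 1 ≤ mulPerm c i × mulPerm c i ≤ n
  mulPerm-range c i = s≤s z≤n , m%n<n ((i ∸ 1) * c) n

  mulPerm-cancel : ∀ {c d} k → d * c ≡ 1 + k * n →
    ∀ i → 1 ≤ i → i ≤ n → mulPerm c (mulPerm d i) ≡ i
  mulPerm-cancel {c} {d} k dc≡1+kn (suc j) _ i≤n = cong suc (begin
    j * d % n * c % n         ≡⟨ %-absorbˡ-* (j * d) c n ⟩
    j * d * c % n             ≡⟨ cong (_% n) (*-assoc j d c) ⟩
    j * (d * c) % n           ≡⟨ cong (λ e → j * e % n) dc≡1+kn ⟩
    j * (1 + k * n) % n       ≡⟨ cong (_% n) (*-distribˡ-+ j 1 (k * n)) ⟩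
    (j * 1 + j * (k * n)) % n ≡⟨ cong₂ (λ u v → (u + v) % n) (*-identityʳ j) (sym (*-assoc j k n)) ⟩
    (j + j * k * n) % n       ≡⟨ [m+kn]%n≡m%n j (j * k) n ⟩
    j % n                     ≡⟨ m<n⇒m%n≡m i≤n ⟩
    j                         ∎)
    where open ≡-Reasoning

  mulPerm-inverse : ∀ {c d} k → c * d ≡ 1 + k * n → IsInverseOn n (mulPerm c) (mulPerm d)
  mulPerm-inverse {c} {d} k cd≡1+kn i 1≤i i≤n =
    mulPerm-range c i , mulPerm-range d i ,
    mulPerm-cancel k (trans (*-comm d c) cd≡1+kn) i 1≤i i≤n ,
    mulPerm-cancel k cd≡1+kn i 1≤i i≤n

  mulPerm-suc : ∀ c m → mulPerm c (suc (suc m)) ≡ suc ((c + m * c % n) % n)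
  mulPerm-suc c m = cong suc (%-absorbʳ-+ c (m * c) n)

  mulPerm-step-up : ∀ c m → c + m * c % n < n →
    + mulPerm c (suc (suc m)) - + mulPerm c (suc m) ≡ + c
  mulPerm-step-up c m no-wrap = begin
    + mulPerm c (suc (suc m)) - + suc r ≡⟨ cong (λ k → + k - + suc r) (mulPerm-suc c m) ⟩
    + suc ((c + r) % n) - + suc r       ≡⟨ cong (λ k → + suc k - + suc r) (m<n⇒m%n≡m no-wrap) ⟩
    + suc (c + r) - + suc r             ≡⟨ cong (λ k → + k - + suc r) (+-suc c r) ⟨
    + (c + suc r) - + suc r             ≡⟨ +[m+n]-+n≡+m c (suc r) ⟩
    + c                                 ∎
    where
    open ≡-Reasoning
    r : ℕ
    r = m * c % n

  mulPerm-step-down : ∀ c m → c < n → n ≤ c + m * c % n →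
    + mulPerm c (suc (suc m)) - + mulPerm c (suc m) ≡ - + (n ∸ c)
  mulPerm-step-down c m c<n wrap = begin
    + mulPerm c (suc (suc m)) - + suc r ≡⟨ cong (λ k → + k - + suc r) (mulPerm-suc c m) ⟩
    + suc s - + suc r                   ≡⟨ cong (λ k → + suc s - + suc k) (%-wrap c<n (m%n<n (m * c) n) wrap) ⟨
    + suc s - + suc (s + (n ∸ c))       ≡⟨ +m-+[m+n]≡-+n (suc s) (n ∸ c) ⟩
    - + (n ∸ c)                         ∎
    where
    open ≡-Reasoning
    r : ℕ
    r = m * c % n
    s : ℕ
    s = (c + r) % n

  mulPerm-derivSet : ∀ c → 2 ≤ c → c < n → DerivSetIs n (mulPerm c) (+ c) (- + (n ∸ c))
  mulPerm-derivSet c 2≤c c<n d = mk⇔ to from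
    where
    instance
      c-nonZero : NonZero c
      c-nonZero = >-nonZero (≤-trans (s≤s z≤n) 2≤c)

    1≤n∸1 : 1 ≤ n ∸ 1
    1≤n∸1 = ∸-monoˡ-≤ 1 (≤-trans 2≤c (<⇒≤ c<n))

    to : DerivValue n (mulPerm c) d → d ≡ + c ⊎ d ≡ - + (n ∸ c)
    to (suc m , _ , _ , refl) with <-≤-connex (c + m * c % n) n
    ... | inj₁ no-wrap = inj₁ (mulPerm-step-up c m no-wrap)
    ... | inj₂ wrap    = inj₂ (mulPerm-step-down c m c<n wrap)

    c+0%n<n : c + 0 % n < n
    c+0%n<n = subst (λ k → c + k < n) (sym (m<n⇒m%n≡m (>-nonZero⁻¹ n))) (subst (_< n) (sym (+-identityʳ c)) c<n)

    q : ℕ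
    q = (n ∸ 1) / c

    q*c%n≡q*c : q * c % n ≡ q * c
    q*c%n≡q*c = m<n⇒m%n≡m (≤-<-trans (m/n*n≤m (n ∸ 1) c) (∸-monoʳ-< (s≤s z≤n) (>-nonZero⁻¹ n)))

    q<n∸1 : q < n ∸ 1
    q<n∸1 = m/n<m (n ∸ 1) c {{>-nonZero 1≤n∸1}} 2≤c

    n≤c+q*c : n ≤ c + q * c
    n≤c+q*c = subst (_≤ c + q * c) (m+[n∸m]≡n (>-nonZero⁻¹ n)) (m<n+[m/n]*n (n ∸ 1) c)

    from : d ≡ + c ⊎ d ≡ - + (n ∸ c) → DerivValue n (mulPerm c) d
    from (inj₁ refl) = 1 , s≤s z≤n , 1≤n∸1 , mulPerm-step-up c 0 c+0%n<n
    from (inj₂ refl) = suc q , s≤s z≤n , q<n∸1 ,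
      mulPerm-step-down c q c<n (subst (λ k → n ≤ c + k) (sym q*c%n≡q*c) n≤c+q*c)

πperm-mulPerm : ∀ k b i → πperm (suc (suc k)) b i ≡ mulPerm (suc (suc k) + b) (suc (suc k)) i
πperm-mulPerm k b i = rep-suc (suc (suc k) + b) ((i ∸ 1) * suc (suc k))

rotateRight : ℕ → ℕ → ℕ
rotateRight b zero = zero
rotateRight b (suc zero) = suc b
rotateRight b (suc (suc m)) = suc m

πperm-one-last : ∀ b → πperm 1 b (suc b) ≡ 1
πperm-one-last b with suc b ≟ suc b
... | yes _ = refl
... | no ≢ = ⊥-elim (≢ refl)

πperm-one-shift : ∀ b i → i ≢ suc b → πperm 1 b i ≡ suc i
πperm-one-shift b i i≢ with i ≟ suc b
... | yes ≡ = ⊥-elim (i≢ ≡)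
... | no _ = refl

πperm-one-range : ∀ b i → i ≤ suc b → 1 ≤ πperm 1 b i × πperm 1 b i ≤ suc b
πperm-one-range b i i≤ with i ≟ suc b
... | yes _ = s≤s z≤n , s≤s z≤n
... | no i≢ = s≤s z≤n , ≤∧≢⇒< i≤ i≢

rotateRight-πperm : ∀ b i → 1 ≤ i → rotateRight b (πperm 1 b i) ≡ i
rotateRight-πperm b i 1≤i with i ≟ suc b
... | yes i≡ = sym i≡
rotateRight-πperm b (suc i) _ | no _ = refl

πperm-rotateRight : ∀ b i → 1 ≤ i → i ≤ suc b → πperm 1 b (rotateRight b i) ≡ i
πperm-rotateRight b (suc zero) _ _ = πperm-one-last b
πperm-rotateRight b (suc (suc m)) _ i≤ = πperm-one-shift b (suc m) (<⇒≢ i≤)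

rotateRight-inverse : ∀ b → IsInverseOn (suc b) (πperm 1 b) (rotateRight b)
rotateRight-inverse b i 1≤i i≤ =
  πperm-one-range b i i≤ , rotateRight-range i 1≤i i≤ ,
  πperm-rotateRight b i 1≤i i≤ , rotateRight-πperm b i 1≤i
  where
  rotateRight-range : ∀ i → 1 ≤ i → i ≤ suc b → 1 ≤ rotateRight b i × rotateRight b i ≤ suc b
  rotateRight-range (suc zero) _ _ = s≤s z≤n , ≤-refl
  rotateRight-range (suc (suc m)) _ i≤ = s≤s z≤n , <⇒≤ i≤

rotateRight-derivSet : ∀ b → 1 < b → DerivSetIs (suc b) (rotateRight b) (+ 1) (- + b)
rotateRight-derivSet b 1<b d = mk⇔ to from
  where
  to : DerivValue (suc b) (rotateRight b) d → d ≡ + 1 ⊎ d ≡ - + b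
  to (suc zero , _ , _ , refl) = inj₂ (+m-+[m+n]≡-+n 1 b)
  to (suc (suc m) , _ , _ , refl) = inj₁ (+[m+n]-+n≡+m 1 (suc m))
  from : d ≡ + 1 ⊎ d ≡ - + b → DerivValue (suc b) (rotateRight b) d
  from (inj₁ refl) = 2 , s≤s z≤n , 1<b , +[m+n]-+n≡+m 1 1
  from (inj₂ refl) = 1 , s≤s z≤n , <⇒≤ 1<b , +m-+[m+n]≡-+n 1 b

corollary2p6 : (a b : ℕ) → 0 < a → a < b → Coprime a b →
    (a′ : ℕ) → 1 ≤ a′ → a′ ≤ a + b ∸ 1 → IsInvMod a (a + b) a′ →
    Σ (ℕ → ℕ) (λ σ → IsInverseOn (sizeN a b) (πperm a b) σ
    × DerivSetIs (sizeN a b) σ (+ a′) (- (+ (a + b ∸ a′))))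
corollary2p6 zero _ ()
corollary2p6 1 b _ 1<b _ a′ _ a′≤b inv
  with IsInvMod-small {1} {suc b} {a′} inv (subst (_< suc b) (sym (*-identityˡ a′)) (s≤s a′≤b))
... | _ , refl = rotateRight b , rotateRight-inverse b , rotateRight-derivSet b 1<b
corollary2p6 a@(suc (suc k)) b _ a<b _ a′ 1≤a′ a′≤n∸1 inv@(j , aa′≡1+jn) =
  mulPerm n a′ ,
  IsInverseOn-congˡ (πperm-mulPerm k b) (mulPerm-inverse n j aa′≡1+jn) ,
  mulPerm-derivSet n a′ 2≤a′ (s≤s a′≤n∸1)
  where
  n : ℕ
  n = a + b
  2≤a′ : 2 ≤ a′
  2≤a′ = ≤∧≢⇒< 1≤a′ (≢-sym (IsInvMod-≢1 inv (s≤s (s≤s z≤n)) (m<m+n a (≤-trans (s≤s z≤n) a<b))))
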